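{- Let $G$ be a nontrivial connected graph of order $n$ with average degree $d$. Then $rd(G)\geq \lfloor d\rfloor$.
   Context: All graphs are simple, finite and undirected. For an edge-coloring of $G$ (adjacent edges may receive the same color), an edge-cut $R$ is a rainbow cut if no two edges of $R$ have the same color; it is a $u$-$v$ rainbow cut if $u$ and $v$ lie in different components of $G-R$. $G$ is rainbow disconnected if every two vertices $u,v$ have a $u$-$v$ rainbow cut. For a nontrivial connected graph $G$, $rd(G)$ is the smallest number of colors in an edge-coloring making $G$ rainbow disconnected. -}

module Defs where

open import Data.Nat using (ℕ; zero; suc; _≤_; _/_; NonZero)
open import Data.Fin using (Fin)
open import Data.Bool using (Bool; true; false; if_then_else_)
open import Data.List using (List; map; allFin)
open import Data.Nat.ListAction using (sum)
open import Data.Product using (_×_; Σ)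
open import Data.Sum using (_⊎_)
open import Relation.Binary.PropositionalEquality using (_≡_)
open import Relation.Nullary using (¬_)

record Graph (n : ℕ) : Set where
  field
    adj     : Fin n → Fin n → Bool
    adj-sym : ∀ i j → adj i j ≡ adj j i
    adj-irr : ∀ i → adj i i ≡ false
open Graph public

deg : ∀ {n} → Graph n → Fin n → ℕ
deg G i = sum (map (λ j → if adj G i j then 1 else 0) (allFin _))

degSum : ∀ {n} → Graph n → ℕ
degSum {n} G = sum (map (deg G) (allFin n))

floorAvgDeg : ∀ {n} → Graph (suc n) → ℕ
floorAvgDeg {n} G = degSum G / suc n

record EdgeSet {n} (G : Graph n) : Set where
  field
    mem     : Fin n → Fin n → Bool
    mem-sym : ∀ i j → mem i j ≡ mem j i
    mem-sub : ∀ i j → mem i j ≡ true → adj G i j ≡ true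
open EdgeSet public

∅E : ∀ {n} (G : Graph n) → EdgeSet G
∅E G = record { mem = λ _ _ → false ; mem-sym = λ _ _ → _≡_.refl ; mem-sub = λ _ _ () }

-- Reach G R u v : there is a u–v walk in G − R
data Reach {n} (G : Graph n) (R : EdgeSet G) (u : Fin n) : Fin n → Set where
  here : Reach G R u u
  step : ∀ {w x} → Reach G R u w → adj G w x ≡ true → mem R w x ≡ false → Reach G R u x

Connected : ∀ {n} → Graph n → Set
Connected G = ∀ u v → Reach G (∅E G) u v

-- An edge-coloring with k colors (adjacent edges may share a color):
-- a color for every edge, independent of the orientation of the edge.
record EdgeColoring {n} (G : Graph n) (k : ℕ) : Set where
  field
    col     : ∀ i j → adj G i j ≡ true → Fin k
    col-sym : ∀ i j (p : adj G i j ≡ true) (q : adj G j i ≡ true) → col i j p ≡ col j i q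
open EdgeColoring public

Rainbow : ∀ {n k} {G : Graph n} → EdgeColoring G k → EdgeSet G → Set
Rainbow {G = G} c R =
  ∀ a b x y (p : mem R a b ≡ true) (q : mem R x y ≡ true) →
    col c a b (mem-sub R a b p) ≡ col c x y (mem-sub R x y q) →
    (a ≡ x × b ≡ y) ⊎ (a ≡ y × b ≡ x)

RainbowCut : ∀ {n k} {G : Graph n} → EdgeColoring G k → Fin n → Fin n → EdgeSet G → Set
RainbowCut {G = G} c u v R = Rainbow c R × ¬ Reach G R u v

RainbowDisconnected : ∀ {n k} {G : Graph n} → EdgeColoring G k → Set
RainbowDisconnected {G = G} c = ∀ u v → ¬ u ≡ v → Σ (EdgeSet G) (RainbowCut c u v)

-- A rainbow u–v cut R uses each colour at most once, so |R| ≤ k, and the set of vertices reachable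
-- from u in G − R has all its boundary edges in R: any two vertices are separated by at most k
-- edges. Such graphs satisfy Mader's bound 2|E| ≤ (k + 1)(n − 1), whence d < k + 1.
--
-- Mader's bound is proved in the manner of Gomory and Hu. Split the terminals X along a minimum
-- a–b cut S and contract either side to a single vertex; by submodularity of cuts and minimality
-- of S, terminal pairs on each side remain separated by at most k edges (uncrossing). Recursively
-- this yields a tree T on the terminals and a projection π of all vertices onto them with
--   ∑ d_T(π u, π v) + 2|T| + 2(k + 1) ≤ 2(k + 1)|X|   (sum over ordered edges uv of G),
-- where d_T(x, y) is 0, 1 or 2 according as x = y, xy ∈ T, or neither: gluing the two trees by an
-- edge, the edges across S add at most cut(S) ≤ 2k and the new tree edge adds 2. For X = V, π is
-- the identity and the left-hand side is at least 4|E| + 2(k + 1).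
module Submission where

open import Data.Nat using (ℕ; zero; suc; _+_; _*_; _≤_; _<_; z≤n; s≤s; _<?_)
open import Data.Nat.Properties hiding (_≟_)
open import Data.Nat.DivMod using (m<n*o⇒m/o<n)
open import Data.Nat.Tactic.RingSolver using (solve-∀)
import Data.Nat.ListAction as List
open import Algebra.Properties.CommutativeMonoid.Sum +-0-commutativeMonoid
  using (sum-cong-≗; ∑-distrib-+; ∑-comm; sum-replicate-zero) renaming (sum to ∑)
open import Algebra.Properties.Semiring.Sum +-*-semiring using (*-distribˡ-sum)
open import Data.Bool using (Bool; true; false; _∧_; _∨_; not; _xor_; if_then_else_)
open import Data.Bool.Properties using (∨-zeroʳ; ∧-zeroʳ; not-involutive) renaming (_≟_ to _≟ᵇ_)
open import Data.Empty using (⊥-elim)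
open import Data.Fin using (Fin; zero; suc; _≟_)
open import Data.Fin.Properties using (any?; all?) renaming (suc-injective to Fin-suc-injective)
open import Data.Fin.Subset.Properties using (anySubset?)
open import Data.List using (map; allFin; tabulate)
open import Data.List.Properties using (map-tabulate)
open import Data.Product using (Σ; _×_; _,_; proj₁; proj₂)
open import Data.Sum using (inj₁; inj₂)
import Data.Vec as Vec
open import Data.Vec.Properties using (lookup∘tabulate)
open import Function using (_∘_)
open import Relation.Binary.PropositionalEquality
open import Relation.Nullary using (¬_; ¬?; Dec; yes; no; does)
open import Relation.Nullary.Decidable using (dec-true; dec-false; _×-dec_; _→-dec_)

open import Defs

⟦_⟧ : Bool → ℕ
⟦ b ⟧ = if b then 1 else 0

⟦⟧≤1 : ∀ b → ⟦ b ⟧ ≤ 1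
⟦⟧≤1 false = z≤n
⟦⟧≤1 true  = s≤s z≤n

∧-true : ∀ x {y} → x ∧ y ≡ true → x ≡ true × y ≡ true
∧-true true y≡true = refl , y≡true

_==_ : ∀ {n} → Fin n → Fin n → Bool
i == j = does (i ≟ j)

==-refl : ∀ {n} (i : Fin n) → (i == i) ≡ true
==-refl i = dec-true (i ≟ i) refl

==⇒≡ : ∀ {n} {i j : Fin n} → (i == j) ≡ true → i ≡ j
==⇒≡ {i = i} {j} eq with i ≟ j
... | yes i≡j = i≡j

≢⇒==false : ∀ {n} {i j : Fin n} → ¬ i ≡ j → (i == j) ≡ false
≢⇒==false {i = i} {j} = dec-false (i ≟ j)

+-≤-cancel : ∀ {x y z w} → x + y ≤ z + w → w ≤ y → x ≤ z
+-≤-cancel {x} {y} {z} x+y≤z+w w≤y = +-cancelʳ-≤ y x z (≤-trans x+y≤z+w (+-monoʳ-≤ z w≤y))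

-- Finite sums

∑-mono-≤ : ∀ {n} {f g : Fin n → ℕ} → (∀ i → f i ≤ g i) → ∑ f ≤ ∑ g
∑-mono-≤ {zero}  f≤g = z≤n
∑-mono-≤ {suc n} f≤g = +-mono-≤ (f≤g zero) (∑-mono-≤ (f≤g ∘ suc))

∑-mono-< : ∀ {n} {f g : Fin n → ℕ} → (∀ i → f i ≤ g i) → ∀ i → f i < g i → ∑ f < ∑ g
∑-mono-< f≤g zero    fi<gi = +-mono-<-≤ fi<gi (∑-mono-≤ (f≤g ∘ suc))
∑-mono-< f≤g (suc i) fi<gi = +-mono-≤-< (f≤g zero) (∑-mono-< (f≤g ∘ suc) i fi<gi)

term≤∑ : ∀ {n} (f : Fin n → ℕ) i → f i ≤ ∑ f
term≤∑ f zero    = m≤m+n (f zero) _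
term≤∑ f (suc i) = ≤-trans (term≤∑ (f ∘ suc) i) (m≤n+m _ (f zero))

∑-zero : ∀ {n} {f : Fin n → ℕ} → (∀ i → f i ≡ 0) → ∑ f ≡ 0
∑-zero {n} f≡0 = trans (sum-cong-≗ f≡0) (sum-replicate-zero n)

∑⟦⟧≤n : ∀ {n} (P : Fin n → Bool) → ∑ (⟦_⟧ ∘ P) ≤ n
∑⟦⟧≤n {zero}  P = z≤n
∑⟦⟧≤n {suc n} P = +-mono-≤ (⟦⟧≤1 (P zero)) (∑⟦⟧≤n (P ∘ suc))

∑⟦⟧≤1 : ∀ {n} (P : Fin n → Bool) → (∀ i j → P i ≡ true → P j ≡ true → i ≡ j) →
        ∑ (⟦_⟧ ∘ P) ≤ 1
∑⟦⟧≤1 {zero}  P unique = z≤n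
∑⟦⟧≤1 {suc n} P unique with P zero in P0
... | false = ∑⟦⟧≤1 (P ∘ suc) (λ i j Pi Pj → Fin-suc-injective (unique (suc i) (suc j) Pi Pj))
... | true  = ≤-reflexive (cong suc (∑-zero rest))
  where
  rest : ∀ i → ⟦ P (suc i) ⟧ ≡ 0
  rest i with P (suc i) in Pi
  ... | false = refl
  ... | true  with () ← unique zero (suc i) P0 Pi

list-sum-allFin : ∀ {n} (f : Fin n → ℕ) → List.sum (map f (allFin n)) ≡ ∑ f
list-sum-allFin {n} f = trans (cong List.sum (map-tabulate (λ i → i) f)) (sum-tabulate n f)
  where
  sum-tabulate : ∀ n (g : Fin n → ℕ) → List.sum (tabulate g) ≡ ∑ g
  sum-tabulate zero    g = refl
  sum-tabulate (suc n) g = cong (g zero +_) (sum-tabulate n (g ∘ suc))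

∑² : ∀ {m n} → (Fin m → Fin n → ℕ) → ℕ
∑² f = ∑ (λ u → ∑ (f u))

∑²-cong : ∀ {m n} {f g : Fin m → Fin n → ℕ} → (∀ u v → f u v ≡ g u v) → ∑² f ≡ ∑² g
∑²-cong f≡g = sum-cong-≗ (λ u → sum-cong-≗ (f≡g u))

∑²-zero : ∀ {m n} {f : Fin m → Fin n → ℕ} → (∀ u v → f u v ≡ 0) → ∑² f ≡ 0
∑²-zero f≡0 = ∑-zero (λ u → ∑-zero (f≡0 u))

∑²-mono-≤ : ∀ {m n} {f g : Fin m → Fin n → ℕ} → (∀ u v → f u v ≤ g u v) → ∑² f ≤ ∑² g
∑²-mono-≤ f≤g = ∑-mono-≤ (λ u → ∑-mono-≤ (f≤g u))

∑²-distrib-+ : ∀ {m n} (f g : Fin m → Fin n → ℕ) →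
               ∑² (λ u v → f u v + g u v) ≡ ∑² f + ∑² g
∑²-distrib-+ f g = trans (sum-cong-≗ (λ u → ∑-distrib-+ (f u) (g u))) (∑-distrib-+ (∑ ∘ f) (∑ ∘ g))

∑²-*ˡ : ∀ {m n} c (f : Fin m → Fin n → ℕ) → c * ∑² f ≡ ∑² (λ u v → c * f u v)
∑²-*ˡ c f = trans (*-distribˡ-sum c (∑ ∘ f)) (sum-cong-≗ (λ u → *-distribˡ-sum c (f u)))

∑²⟦⟧≤1 : ∀ {m n} (P : Fin m → Fin n → Bool) →
         (∀ {u v u′ v′} → P u v ≡ true → P u′ v′ ≡ true → u ≡ u′ × v ≡ v′) →
         ∑² (λ u v → ⟦ P u v ⟧) ≤ 1
∑²⟦⟧≤1 {zero}  P unique = z≤n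
∑²⟦⟧≤1 {suc m} P unique with any? (λ v → P zero v ≟ᵇ true)
... | yes (v , P0v) = begin
  row₀ + ∑² (λ u v → ⟦ P (suc u) v ⟧) ≡⟨ cong (row₀ +_) (∑-zero (λ u → ∑-zero (rest u))) ⟩
  row₀ + 0                            ≡⟨ +-identityʳ row₀ ⟩
  row₀                                ≤⟨ ∑⟦⟧≤1 (P zero) (λ i j Pi Pj → proj₂ (unique Pi Pj)) ⟩
  1                                   ∎
  where
  open ≤-Reasoning
  row₀ = ∑ (⟦_⟧ ∘ P zero)
  rest : ∀ u v → ⟦ P (suc u) v ⟧ ≡ 0
  rest u v with P (suc u) v in Puv
  ... | false = refl
  ... | true  with () ← proj₁ (unique P0v Puv)
... | no ¬P0v = subst (_≤ 1) (cong (_+ ∑² (λ u v → ⟦ P (suc u) v ⟧)) (sym (∑-zero row₀≡0)))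
                  (∑²⟦⟧≤1 (P ∘ suc) unique′)
  where
  row₀≡0 : ∀ v → ⟦ P zero v ⟧ ≡ 0
  row₀≡0 v with P zero v in P0v
  ... | false = refl
  ... | true  = ⊥-elim (¬P0v (v , P0v))
  unique′ : ∀ {u v u′ v′} → P (suc u) v ≡ true → P (suc u′) v′ ≡ true → u ≡ u′ × v ≡ v′
  unique′ p p′ with unique p p′
  ... | refl , v≡v′ = refl , v≡v′

-- Summing over the k colours, each colour class contains at most one pair.
∑²⟦⟧≤-injective-colouring :
  ∀ {m n k} (P : Fin m → Fin n → Bool) (c : ∀ u v → P u v ≡ true → Fin k) →
  (∀ {u v u′ v′} p p′ → c u v p ≡ c u′ v′ p′ → u ≡ u′ × v ≡ v′) →
  ∑² (λ u v → ⟦ P u v ⟧) ≤ k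
∑²⟦⟧≤-injective-colouring {m} {n} {k} P c injective = begin
  ∑² (λ u v → ⟦ P u v ⟧)
    ≤⟨ ∑²-mono-≤ (λ u v → ⟦⟧≤∑colour (P u v) (c u v)) ⟩
  ∑² (λ u v → ∑ (λ j → ⟦ coloured u v j ⟧))
    ≡⟨ sum-cong-≗ (λ u → ∑-comm (λ v j → ⟦ coloured u v j ⟧)) ⟩
  ∑ (λ u → ∑ (λ j → ∑ (λ v → ⟦ coloured u v j ⟧)))
    ≡⟨ ∑-comm (λ u j → ∑ (λ v → ⟦ coloured u v j ⟧)) ⟩
  ∑ (λ j → ∑² (λ u v → ⟦ coloured u v j ⟧))
    ≤⟨ ∑-mono-≤ {k} (λ j → ∑²⟦⟧≤1 (λ u v → coloured u v j) unique) ⟩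
  ∑ {k} (λ _ → ⟦ true ⟧)
    ≤⟨ ∑⟦⟧≤n {k} (λ _ → true) ⟩
  k ∎
  where
  open ≤-Reasoning
  hasColour : (b : Bool) → (b ≡ true → Fin k) → Fin k → Bool
  hasColour true  f j = f refl == j
  hasColour false f j = false

  coloured : Fin m → Fin n → Fin k → Bool
  coloured u v = hasColour (P u v) (c u v)

  ⟦⟧≤∑colour : ∀ b f → ⟦ b ⟧ ≤ ∑ (⟦_⟧ ∘ hasColour b f)
  ⟦⟧≤∑colour true  f = ≤-trans (≤-reflexive (cong ⟦_⟧ (sym (==-refl (f refl)))))
                                (term≤∑ (⟦_⟧ ∘ hasColour true f) (f refl))
  ⟦⟧≤∑colour false f = z≤n

  colour-witness : ∀ b f j → hasColour b f j ≡ true → Σ (b ≡ true) λ p → f p ≡ j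
  colour-witness true f j eq = refl , ==⇒≡ eq

  unique : ∀ {j u v u′ v′} → coloured u v j ≡ true → coloured u′ v′ j ≡ true →
           u ≡ u′ × v ≡ v′
  unique {j} {u} {v} {u′} {v′} h h′
    with colour-witness (P u v) (c u v) j h | colour-witness (P u′ v′) (c u′ v′) j h′
  ... | p , cp | p′ , cp′ = injective p p′ (trans cp (sym cp′))

-- Cuts

∁ : ∀ {n} → (Fin n → Bool) → Fin n → Bool
∁ S i = not (S i)

_∩_ _∪_ : ∀ {n} → (Fin n → Bool) → (Fin n → Bool) → Fin n → Bool
(S ∩ T) i = S i ∧ T i
(S ∪ T) i = S i ∨ T i

⁅_⁆ : ∀ {n} → Fin n → Fin n → Bool
⁅ x ⁆ i = i == x

size : ∀ {n} → (Fin n → Bool) → ℕ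
size S = ∑ (⟦_⟧ ∘ S)

size-split : ∀ {n} (X S : Fin n → Bool) → size X ≡ size (X ∩ S) + size (X ∩ ∁ S)
size-split {n} X S = trans (sum-cong-≗ (λ u → split (X u) (S u))) (∑-distrib-+ {n} _ _)
  where
  split : ∀ x s → ⟦ x ⟧ ≡ ⟦ x ∧ s ⟧ + ⟦ x ∧ not s ⟧
  split true  true  = refl
  split true  false = refl
  split false s     = refl

size-≥1 : ∀ {n} {S : Fin n → Bool} {x} → S x ≡ true → 1 ≤ size S
size-≥1 {S = S} {x} Sx = ≤-trans (≤-reflexive (cong ⟦_⟧ (sym Sx))) (term≤∑ (⟦_⟧ ∘ S) x)

-- Needs P and f to respect pointwise equality because the search runs over Vec Bool n.
minimise : ∀ {n} (P : (Fin n → Bool) → Set) (f : (Fin n → Bool) → ℕ) → (∀ S → Dec (P S)) →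
           (∀ {S T} → (∀ i → S i ≡ T i) → P S → P T) →
           (∀ {S T} → (∀ i → S i ≡ T i) → f S ≡ f T) →
           ∀ {S₀} → P S₀ → Σ (Fin n → Bool) λ S → P S × (∀ T → P T → f S ≤ f T)
minimise {n} P f P? P-resp f-resp {S₀} PS₀ = descend (f S₀) S₀ PS₀ ≤-refl
  where
  descend : ∀ m S → P S → f S ≤ m → Σ (Fin n → Bool) λ S → P S × (∀ T → P T → f S ≤ f T)
  descend zero    S PS fS≤0 = S , PS , λ T _ → ≤-trans fS≤0 z≤n
  descend (suc m) S PS fS≤m
    with anySubset? (λ p → P? (Vec.lookup p) ×-dec (f (Vec.lookup p) <? f S))
  ... | yes (p , Pp , fp<fS) = descend m (Vec.lookup p) Pp (≤-pred (≤-trans fp<fS fS≤m))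
  ... | no ¬smaller = S , PS , λ T PT → ≮⇒≥ λ fT<fS →
          ¬smaller (Vec.tabulate T , P-resp (λ i → sym (lookup∘tabulate T i)) PT ,
                    subst (_< f S) (f-resp (λ i → sym (lookup∘tabulate T i))) fT<fS)

xor-submodular : ∀ x y x′ y′ →
  ⟦ (x ∧ y) xor (x′ ∧ y′) ⟧ + ⟦ (x ∨ y) xor (x′ ∨ y′) ⟧ ≤ ⟦ x xor x′ ⟧ + ⟦ y xor y′ ⟧
xor-submodular true  true  true  true  = ≤ᵇ⇒≤ _ _ _
xor-submodular true  true  true  false = ≤ᵇ⇒≤ _ _ _
xor-submodular true  true  false true  = ≤ᵇ⇒≤ _ _ _
xor-submodular true  true  false false = ≤ᵇ⇒≤ _ _ _
xor-submodular true  false true  true  = ≤ᵇ⇒≤ _ _ _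
xor-submodular true  false true  false = ≤ᵇ⇒≤ _ _ _
xor-submodular true  false false true  = ≤ᵇ⇒≤ _ _ _
xor-submodular true  false false false = ≤ᵇ⇒≤ _ _ _
xor-submodular false true  true  true  = ≤ᵇ⇒≤ _ _ _
xor-submodular false true  true  false = ≤ᵇ⇒≤ _ _ _
xor-submodular false true  false true  = ≤ᵇ⇒≤ _ _ _
xor-submodular false true  false false = ≤ᵇ⇒≤ _ _ _
xor-submodular false false true  true  = ≤ᵇ⇒≤ _ _ _
xor-submodular false false true  false = ≤ᵇ⇒≤ _ _ _
xor-submodular false false false true  = ≤ᵇ⇒≤ _ _ _
xor-submodular false false false false = ≤ᵇ⇒≤ _ _ _

module _ {N} (G : Graph N) where

  -- Sums over ordered pairs, so every edge between S and ∁ S is counted twice.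
  cut : (Fin N → Bool) → ℕ
  cut S = ∑² (λ u v → ⟦ adj G u v ⟧ * ⟦ S u xor S v ⟧)

  cut-cong : ∀ {S T} → (∀ i → S i ≡ T i) → cut S ≡ cut T
  cut-cong S≗T = ∑²-cong (λ u v → cong (λ b → ⟦ adj G u v ⟧ * ⟦ b ⟧) (cong₂ _xor_ (S≗T u) (S≗T v)))

  cut-∁ : ∀ S → cut (∁ S) ≡ cut S
  cut-∁ S = ∑²-cong (λ u v → cong (λ b → ⟦ adj G u v ⟧ * ⟦ b ⟧) (not-xor (S u) (S v)))
    where
    not-xor : ∀ x y → (not x xor not y) ≡ (x xor y)
    not-xor true  y = refl
    not-xor false y = not-involutive y

  cut-submodular : ∀ S T → cut (S ∩ T) + cut (S ∪ T) ≤ cut S + cut T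
  cut-submodular S T = begin
    cut (S ∩ T) + cut (S ∪ T)
      ≡⟨ ∑²-distrib-+ {N} {N} _ _ ⟨
    ∑² (λ u v → ⟦ adj G u v ⟧ * ⟦ (S ∩ T) u xor (S ∩ T) v ⟧
              + ⟦ adj G u v ⟧ * ⟦ (S ∪ T) u xor (S ∪ T) v ⟧)
      ≤⟨ ∑²-mono-≤ (λ u v → scaled ⟦ adj G u v ⟧ (xor-submodular (S u) (T u) (S v) (T v))) ⟩
    ∑² (λ u v → ⟦ adj G u v ⟧ * ⟦ S u xor S v ⟧ + ⟦ adj G u v ⟧ * ⟦ T u xor T v ⟧)
      ≡⟨ ∑²-distrib-+ {N} {N} _ _ ⟩
    cut S + cut T ∎
    where
    open ≤-Reasoning
    scaled : ∀ e {a b c d} → a + b ≤ c + d → e * a + e * b ≤ e * c + e * d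
    scaled e {a} {b} {c} {d} le =
      subst₂ _≤_ (*-distribˡ-+ e a b) (*-distribˡ-+ e c d) (*-monoʳ-≤ e le)

-- Rainbow cuts

module _ {N} (G : Graph N) (R : EdgeSet G) where

  Closed : (Fin N → Bool) → Set
  Closed S = ∀ {w x} → S w ≡ true → adj G w x ≡ true → mem R w x ≡ false → S x ≡ true

  Escapes : (Fin N → Bool) → Fin N → Fin N → Set
  Escapes T w x = T w ≡ true × adj G w x ≡ true × mem R w x ≡ false × T x ≡ false

  escapes? : ∀ T w x → Dec (Escapes T w x)
  escapes? T w x =
    (T w ≟ᵇ true) ×-dec (adj G w x ≟ᵇ true) ×-dec (mem R w x ≟ᵇ false) ×-dec (T x ≟ᵇ false)

  module _ (a : Fin N) where

    ReachableSet : (Fin N → Bool) → Set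
    ReachableSet T = T a ≡ true × (∀ x → T x ≡ true → Reach G R a x)

    enlarge : ∀ {T w x} → ReachableSet T → Escapes T w x →
              ReachableSet (T ∪ ⁅ x ⁆) × size T < size (T ∪ ⁅ x ⁆)
    enlarge {T} {w} {x} (Ta , T⊆reach) (Tw , wx , ¬Rwx , Tx) =
      (cong (_∨ _) Ta , T′⊆reach) , |T|<|T′|
      where
      ⟦⟧≤⟦∨⟧ : ∀ b c → ⟦ b ⟧ ≤ ⟦ b ∨ c ⟧
      ⟦⟧≤⟦∨⟧ true  c = ≤-refl
      ⟦⟧≤⟦∨⟧ false c = z≤n
      |T|<|T′| : size T < size (T ∪ ⁅ x ⁆)
      |T|<|T′| = ∑-mono-< (λ y → ⟦⟧≤⟦∨⟧ (T y) (y == x)) x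
                   (subst₂ (λ b c → ⟦ b ⟧ < ⟦ b ∨ c ⟧) (sym Tx) (sym (==-refl x)) ≤-refl)
      T′⊆reach : ∀ y → (T ∪ ⁅ x ⁆) y ≡ true → Reach G R a y
      T′⊆reach y T′y with T y in Ty
      ... | true  = T⊆reach y Ty
      ... | false = subst (Reach G R a) (sym (==⇒≡ T′y)) (step (T⊆reach w Tw) wx ¬Rwx)

    -- Enlarge ⁅ a ⁆ along escaping edges; fuel N suffices since every step adds a vertex.
    closed-reachable-set : Σ (Fin N → Bool) λ S → ReachableSet S × Closed S
    closed-reachable-set = extend N ⁅ a ⁆ reach-⁅a⁆ (m≤m+n N _)
      where
      open ≤-Reasoning

      reach-⁅a⁆ : ReachableSet ⁅ a ⁆
      reach-⁅a⁆ = ==-refl a , λ x x==a → subst (Reach G R a) (sym (==⇒≡ x==a)) here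

      extend : ∀ m T → ReachableSet T → N ≤ m + size T →
               Σ (Fin N → Bool) λ S → ReachableSet S × Closed S
      extend m T reachT N≤m+|T| with any? (λ w → any? (escapes? T w))
      ... | no ¬escape = T , reachT , closed
        where
        closed : Closed T
        closed {w} {x} Tw wx ¬Rwx with T x in Tx
        ... | true  = refl
        ... | false = ⊥-elim (¬escape (w , x , Tw , wx , ¬Rwx , Tx))
      ... | yes (w , x , esc) with enlarge reachT esc | m
      ...   | _ , |T|<|T′| | zero =
        ⊥-elim (<⇒≱ (≤-trans |T|<|T′| (∑⟦⟧≤n (T ∪ ⁅ x ⁆))) N≤m+|T|)
      ...   | reachT′ , |T|<|T′| | suc m′ =
        extend m′ (T ∪ ⁅ x ⁆) reachT′ (begin
          N                     ≤⟨ N≤m+|T| ⟩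
          suc m′ + size T       ≡⟨ +-suc m′ (size T) ⟨
          m′ + suc (size T)     ≤⟨ +-monoʳ-≤ m′ |T|<|T′| ⟩
          m′ + size (T ∪ ⁅ x ⁆) ∎)

  module _ {k} (c : EdgeColoring G k) (rainbow : Rainbow c R) where

    ∑²⟦⟧≤-rainbow-oriented : (P : Fin N → Fin N → Bool) →
      (∀ {u v} → P u v ≡ true → mem R u v ≡ true) → (∀ {u v} → P u v ≡ true → P v u ≡ false) →
      ∑² (λ u v → ⟦ P u v ⟧) ≤ k
    ∑²⟦⟧≤-rainbow-oriented P P⊆R oriented =
      ∑²⟦⟧≤-injective-colouring P (λ u v p → col c u v (mem-sub R u v (P⊆R p))) injective
      where
      injective : ∀ {u v u′ v′} (p : P u v ≡ true) (p′ : P u′ v′ ≡ true) →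
                  col c u v (mem-sub R u v (P⊆R p)) ≡ col c u′ v′ (mem-sub R u′ v′ (P⊆R p′)) →
                  u ≡ u′ × v ≡ v′
      injective {u} {v} {u′} {v′} p p′ same-colour
        with rainbow u v u′ v′ (P⊆R p) (P⊆R p′) same-colour
      ... | inj₁ same-edge     = same-edge
      ... | inj₂ (refl , refl) with () ← trans (sym (oriented p)) p′

    closed-cut≤ : ∀ {S} → Closed S → cut G S ≤ 2 * k
    closed-cut≤ {S} closed = begin
      cut G S                                                   ≡⟨ ∑²-cong split ⟩
      ∑² (λ u v → ⟦ leaves u v ⟧ + ⟦ leaves v u ⟧)              ≡⟨ ∑²-distrib-+ {N} {N} _ _ ⟩
      ∑² (λ u v → ⟦ leaves u v ⟧) + ∑² (λ u v → ⟦ leaves v u ⟧) ≤⟨ +-mono-≤ out-bound in-bound ⟩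
      k + k                                                     ≡⟨ cong (k +_) (+-identityʳ k) ⟨
      2 * k                                                     ∎
      where
      open ≤-Reasoning
      leaves : Fin N → Fin N → Bool
      leaves u v = adj G u v ∧ S u ∧ not (S v)

      xor-split : ∀ a x y → ⟦ a ⟧ * ⟦ x xor y ⟧ ≡ ⟦ a ∧ x ∧ not y ⟧ + ⟦ a ∧ y ∧ not x ⟧
      xor-split false x     y     = refl
      xor-split true  true  true  = refl
      xor-split true  true  false = refl
      xor-split true  false true  = refl
      xor-split true  false false = refl

      split : ∀ u v → ⟦ adj G u v ⟧ * ⟦ S u xor S v ⟧ ≡ ⟦ leaves u v ⟧ + ⟦ leaves v u ⟧
      split u v = trans (xor-split (adj G u v) (S u) (S v))
                        (cong (λ b → ⟦ leaves u v ⟧ + ⟦ b ∧ S v ∧ not (S u) ⟧) (adj-sym G u v))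

      leaves⊆R : ∀ {u v} → leaves u v ≡ true → mem R u v ≡ true
      leaves⊆R {u} {v} l with adj G u v in uv | S u in Su | S v in Sv | mem R u v in Ruv
      ... | true | true | false | true  = refl
      ... | true | true | false | false with () ← trans (sym (closed Su uv Ruv)) Sv

      oriented : ∀ {u v} → leaves u v ≡ true → leaves v u ≡ false
      oriented {u} {v} l with adj G u v | S u | S v
      ... | true | true | false = ∧-zeroʳ (adj G v u)

      out-bound : ∑² (λ u v → ⟦ leaves u v ⟧) ≤ k
      out-bound = ∑²⟦⟧≤-rainbow-oriented leaves leaves⊆R (λ {u} {v} → oriented {u} {v})

      in-bound : ∑² (λ u v → ⟦ leaves v u ⟧) ≤ k
      in-bound = ∑²⟦⟧≤-rainbow-oriented (λ u v → leaves v u)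
                   (λ {u} {v} l → trans (mem-sym R u v) (leaves⊆R l)) (λ {u} {v} → oriented {v} {u})

-- Contractions and minimum cuts

module _ {n : ℕ} where

  Saturated : (Fin n → Fin n → Bool) → (Fin n → Bool) → Set
  Saturated same S = ∀ u v → same u v ≡ true → S u ≡ S v

  SeparatingSet : (Fin n → Fin n → Bool) → Fin n → Fin n → (Fin n → Bool) → Set
  SeparatingSet same a b S = Saturated same S × S a ≡ true × S b ≡ false

  saturated-∁ : ∀ {same S} → Saturated same S → Saturated same (∁ S)
  saturated-∁ sat u v uv = cong not (sat u v uv)

  saturated-∪ : ∀ {same S T} → Saturated same S → Saturated same T → Saturated same (S ∪ T)
  saturated-∪ satS satT u v uv = cong₂ _∨_ (satS u v uv) (satT u v uv)

  saturated-∩ : ∀ {same S T} → Saturated same S → Saturated same T → Saturated same (S ∩ T)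
  saturated-∩ satS satT u v uv = cong₂ _∧_ (satS u v uv) (satT u v uv)

  separating-∁ : ∀ {same a b S} → SeparatingSet same a b S → SeparatingSet same b a (∁ S)
  separating-∁ (sat , Sa , Sb) = saturated-∁ sat , cong not Sb , cong not Sa

  -- The contraction of ∁ S to a single vertex, in a graph whose vertex classes are given by same.
  collapse : (Fin n → Bool) → (Fin n → Fin n → Bool) → Fin n → Fin n → Bool
  collapse S same u v = (not (S u) ∧ not (S v)) ∨ (S u ∧ S v ∧ same u v)

  collapse-inside : ∀ {S same} u v → S u ≡ true → S v ≡ true → collapse S same u v ≡ same u v
  collapse-inside u v Su Sv rewrite Su | Sv = refl

  collapse-outside : ∀ {S same} u v → S u ≡ false → S v ≡ false → collapse S same u v ≡ true
  collapse-outside u v Su Sv rewrite Su | Sv = refl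

  saturated-collapse : ∀ {S same T} →
    (∀ {u v} → S u ≡ true → S v ≡ true → same u v ≡ true → T u ≡ T v) →
    (∀ {u v} → S u ≡ false → S v ≡ false → T u ≡ T v) →
    Saturated (collapse S same) T
  saturated-collapse {S} inside outside u v uv with S u in Su | S v in Sv
  ... | true  | true  = inside Su Sv uv
  ... | false | false = outside Su Sv

module _ {N} (G : Graph N) where

  MinCut : (Fin N → Fin N → Bool) → Fin N → Fin N → (Fin N → Bool) → Set
  MinCut same a b S = SeparatingSet same a b S × (∀ T → SeparatingSet same a b T → cut G S ≤ cut G T)

  Separable : ℕ → (Fin N → Bool) → (Fin N → Fin N → Bool) → Set
  Separable k X same = ∀ {a b} → X a ≡ true → X b ≡ true → ¬ a ≡ b →
                       Σ (Fin N → Bool) λ S → SeparatingSet same a b S × cut G S ≤ 2 * k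

  min-cut : ∀ same a b {S₀} → SeparatingSet same a b S₀ → Σ (Fin N → Bool) (MinCut same a b)
  min-cut same a b = minimise (SeparatingSet same a b) (cut G) separating? separating-resp (cut-cong G)
    where
    separating? : ∀ S → Dec (SeparatingSet same a b S)
    separating? S = all? (λ u → all? (λ v → (same u v ≟ᵇ true) →-dec (S u ≟ᵇ S v)))
                    ×-dec (S a ≟ᵇ true) ×-dec (S b ≟ᵇ false)
    separating-resp : ∀ {S T} → (∀ i → S i ≡ T i) →
                      SeparatingSet same a b S → SeparatingSet same a b T
    separating-resp S≗T (sat , Sa , Sb) =
      (λ u v uv → trans (sym (S≗T u)) (trans (sat u v uv) (S≗T v))) ,
      trans (sym (S≗T a)) Sa , trans (sym (S≗T b)) Sb

  min-cut-∁ : ∀ {same a b S} → MinCut same a b S → MinCut same b a (∁ S)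
  min-cut-∁ {S = S} (sep , minimal) =
    separating-∁ sep ,
    λ T sepT → subst₂ _≤_ (sym (cut-∁ G S)) (cut-∁ G T) (minimal (∁ T) (separating-∁ sepT))

  -- Y ∪ S separates a from b, so by minimality it cuts no less than S.
  min-cut-∩ : ∀ {same a b S Y} → MinCut same a b S → Saturated same Y → Y b ≡ false →
              cut G (Y ∩ S) ≤ cut G Y
  min-cut-∩ {a = a} {S = S} {Y} ((satS , Sa , Sb) , minimal) satY Yb =
    +-≤-cancel (cut-submodular G Y S) (minimal (Y ∪ S) Y∪S-separates)
    where
    Y∪S-separates : SeparatingSet _ a _ (Y ∪ S)
    Y∪S-separates = saturated-∪ satY satS , trans (cong (Y a ∨_) Sa) (∨-zeroʳ (Y a)) , cong₂ _∨_ Yb Sb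

  -- ∁ (Y ∩ ∁ S) separates a from b, so by minimality it cuts no less than S.
  min-cut-∪∁ : ∀ {same a b S Y} → MinCut same a b S → Saturated same Y → Y b ≡ true →
               cut G (Y ∪ ∁ S) ≤ cut G Y
  min-cut-∪∁ {a = a} {S = S} {Y} ((satS , Sa , Sb) , minimal) satY Yb =
    +-≤-cancel submodular (minimal (∁ (Y ∩ ∁ S)) ∁Y∩∁S-separates)
    where
    ∁Y∩∁S-separates : SeparatingSet _ a _ (∁ (Y ∩ ∁ S))
    ∁Y∩∁S-separates = saturated-∁ (saturated-∩ satY (saturated-∁ satS)) ,
                      trans (cong (λ s → not (Y a ∧ not s)) Sa) (cong not (∧-zeroʳ (Y a))) ,
                      cong₂ (λ y s → not (y ∧ not s)) Yb Sb
    submodular : cut G (Y ∪ ∁ S) + cut G (∁ (Y ∩ ∁ S)) ≤ cut G Y + cut G S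
    submodular = subst₂ _≤_
      (trans (+-comm (cut G (Y ∩ ∁ S)) _) (cong (cut G (Y ∪ ∁ S) +_) (sym (cut-∁ G (Y ∩ ∁ S)))))
      (cong (cut G Y +_) (cut-∁ G S))
      (cut-submodular G Y (∁ S))

  uncross : ∀ {k X same a b S} → MinCut same a b S → Separable k X same →
            Separable k (X ∩ S) (collapse S same)
  uncross {X = X} {b = b} {S} minS separable {a₁} {b₁} XSa₁ XSb₁ a₁≢b₁
    with ∧-true (X a₁) XSa₁ | ∧-true (X b₁) XSb₁
  ... | Xa₁ , Sa₁ | Xb₁ , Sb₁ with separable Xa₁ Xb₁ a₁≢b₁
  ...   | Y , (satY , Ya₁ , Yb₁) , cutY≤2k with Y b in Yb
  ...     | false =
    Y ∩ S ,
    (saturated-collapse (λ Su Sv uv → cong₂ _∧_ (satY _ _ uv) (trans Su (sym Sv)))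
                        (λ Su Sv → trans (∩-outside Su) (sym (∩-outside Sv))) ,
     cong₂ _∧_ Ya₁ Sa₁ , cong (_∧ S b₁) Yb₁) ,
    ≤-trans (min-cut-∩ minS satY Yb) cutY≤2k
    where
    ∩-outside : ∀ {u} → S u ≡ false → (Y ∩ S) u ≡ false
    ∩-outside {u} Su = trans (cong (Y u ∧_) Su) (∧-zeroʳ (Y u))
  ...     | true  =
    Y ∪ ∁ S ,
    (saturated-collapse (λ Su Sv uv → cong₂ _∨_ (satY _ _ uv) (cong not (trans Su (sym Sv))))
                        (λ Su Sv → trans (∪∁-outside Su) (sym (∪∁-outside Sv))) ,
     cong (_∨ not (S a₁)) Ya₁ , cong₂ _∨_ Yb₁ (cong not Sb₁)) ,
    ≤-trans (min-cut-∪∁ minS satY Yb) cutY≤2k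
    where
    ∪∁-outside : ∀ {u} → S u ≡ false → (Y ∪ ∁ S) u ≡ true
    ∪∁-outside {u} Su = trans (cong (λ s → Y u ∨ not s) Su) (∨-zeroʳ (Y u))

-- Gomory–Hu skeletons

gap : ℕ → ℕ
gap zero    = 2
gap (suc _) = 1

-- The distance d_T of the tree whose edge multiplicities are w; only w x y ≠ 0 matters.
dist : ∀ {n} → (Fin n → Fin n → ℕ) → Fin n → Fin n → ℕ
dist w x y = if x == y then 0 else gap (w x y)

module _ {n} (w : Fin n → Fin n → ℕ) where

  dist-≤2 : ∀ x y → dist w x y ≤ 2
  dist-≤2 x y with x == y | w x y
  ... | true  | _     = z≤n
  ... | false | zero  = ≤-refl
  ... | false | suc _ = s≤s z≤n

  dist-≥1 : ∀ {x y} → ¬ x ≡ y → 1 ≤ dist w x y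
  dist-≥1 {x} {y} x≢y rewrite ≢⇒==false x≢y with w x y
  ... | zero  = s≤s z≤n
  ... | suc _ = ≤-refl

  dist-≤1 : ∀ {x y} → 1 ≤ w x y → dist w x y ≤ 1
  dist-≤1 {x} {y} 1≤wxy with x == y | w x y
  ... | true  | _     = z≤n
  ... | false | suc _ = ≤-refl

  dist-antitone : ∀ {w′ : Fin n → Fin n → ℕ} x y → w x y ≤ w′ x y → dist w′ x y ≤ dist w x y
  dist-antitone {w′} x y wxy≤w′xy with x == y | w x y | w′ x y
  ... | true  | _     | _     = z≤n
  ... | false | zero  | zero  = ≤-refl
  ... | false | zero  | suc _ = s≤s z≤n
  ... | false | suc _ | suc _ = ≤-refl

  2≤dist+weight : ∀ {x y} → ¬ x ≡ y → 2 ≤ dist w x y + w x y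
  2≤dist+weight {x} {y} x≢y rewrite ≢⇒==false x≢y with w x y
  ... | zero  = ≤-refl
  ... | suc _ = s≤s (s≤s z≤n)

dist-via-edge : ∀ {n} (w w₁ w₂ : Fin n → Fin n → ℕ) {α β} → 1 ≤ w α β →
                ∀ x y → dist w x y ≤ dist w₁ x α + dist w₂ β y + 1
dist-via-edge w w₁ w₂ {α} {β} 1≤wαβ x y = by-cases (x ≟ α) (β ≟ y)
  where
  by-cases : Dec (x ≡ α) → Dec (β ≡ y) → dist w x y ≤ dist w₁ x α + dist w₂ β y + 1
  by-cases (yes refl) (yes refl) = ≤-trans (dist-≤1 w 1≤wαβ) (m≤n+m 1 _)
  by-cases (no x≢α)   _          = ≤-trans (dist-≤2 w x y)
                                     (+-monoˡ-≤ 1 (≤-trans (dist-≥1 w₁ x≢α) (m≤m+n _ (dist w₂ β y))))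
  by-cases (yes _)    (no β≢y)   = ≤-trans (dist-≤2 w x y)
                                     (+-monoˡ-≤ 1 (≤-trans (dist-≥1 w₂ β≢y) (m≤n+m _ (dist w₁ x α))))

module _ {N} (G : Graph N) (k : ℕ) where

  cost : (Fin N → Fin N → ℕ) → (Fin N → Fin N) → ℕ
  cost w π = ∑² (λ u v → ⟦ adj G u v ⟧ * dist w (π u) (π v))

  -- weight records the tree T in both orientations (so ∑² weight = 2|T|), proj is π.
  record Skeleton (X : Fin N → Bool) (same : Fin N → Fin N → Bool) : Set where
    field
      weight         : Fin N → Fin N → ℕ
      proj           : Fin N → Fin N
      proj-saturated : ∀ u v → same u v ≡ true → proj u ≡ proj v
      proj-fixes     : ∀ x → X x ≡ true → proj x ≡ x
      bound          : cost weight proj + ∑² weight + 2 * suc k ≤ 2 * suc k * size X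

  singleton-skeleton : ∀ {X same x₀} → X x₀ ≡ true → (∀ x → X x ≡ true → x₀ ≡ x) → Skeleton X same
  singleton-skeleton {X} {x₀ = x₀} Xx₀ only-x₀ = record
    { weight         = λ _ _ → 0
    ; proj           = λ _ → x₀
    ; proj-saturated = λ _ _ _ → refl
    ; proj-fixes     = only-x₀
    ; bound          = begin
        cost (λ _ _ → 0) (λ _ → x₀) + ∑² {N} {N} (λ _ _ → 0) + 2 * suc k
          ≡⟨ cong₂ (λ c s → c + s + 2 * suc k) (∑²-zero {N} {N} no-cost)
                                                (∑²-zero {N} {N} λ _ _ → refl) ⟩
        2 * suc k          ≡⟨ *-identityʳ _ ⟨
        2 * suc k * 1      ≤⟨ *-monoʳ-≤ (2 * suc k) (size-≥1 {S = X} Xx₀) ⟩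
        2 * suc k * size X ∎
    }
    where
    open ≤-Reasoning
    no-cost : ∀ u v → ⟦ adj G u v ⟧ * dist (λ _ _ → 0) x₀ x₀ ≡ 0
    no-cost u v rewrite ==-refl x₀ = *-zeroʳ ⟦ adj G u v ⟧

  module Glue {X same a b S} (minS : MinCut G same a b S) (cutS≤2k : cut G S ≤ 2 * k)
              (sk₁ : Skeleton (X ∩ S) (collapse S same))
              (sk₂ : Skeleton (X ∩ ∁ S) (collapse (∁ S) same)) where

    private
      module ₁ = Skeleton sk₁
      module ₂ = Skeleton sk₂
      satS = proj₁ (proj₁ minS)
      Sa = proj₁ (proj₂ (proj₁ minS))
      Sb = proj₂ (proj₂ (proj₁ minS))

    α β : Fin N
    α = ₁.proj b
    β = ₂.proj a

    edge : Fin N → Fin N → ℕ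
    edge x y = ⟦ x == α ∧ y == β ⟧ + ⟦ x == β ∧ y == α ⟧

    weight : Fin N → Fin N → ℕ
    weight x y = ₁.weight x y + ₂.weight x y + edge x y

    proj : Fin N → Fin N
    proj u = if S u then ₁.proj u else ₂.proj u

    proj₁-outside : ∀ {v} → S v ≡ false → ₁.proj v ≡ α
    proj₁-outside {v} Sv = ₁.proj-saturated v b (collapse-outside {same = same} v b Sv Sb)

    proj₂-inside : ∀ {u} → S u ≡ true → ₂.proj u ≡ β
    proj₂-inside {u} Su = ₂.proj-saturated u a (collapse-outside {same = same} u a (cong not Su) (cong not Sa))

    proj-saturated : ∀ u v → same u v ≡ true → proj u ≡ proj v
    proj-saturated u v uv with S u in Su | S v in Sv
    ... | true  | true  = ₁.proj-saturated u v (trans (collapse-inside {same = same} u v Su Sv) uv)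
    ... | false | false =
      ₂.proj-saturated u v (trans (collapse-inside {same = same} u v (cong not Su) (cong not Sv)) uv)
    ... | true  | false with () ← trans (sym Su) (trans (satS u v uv) Sv)
    ... | false | true  with () ← trans (sym Sv) (trans (sym (satS u v uv)) Su)

    proj-fixes : ∀ x → X x ≡ true → proj x ≡ x
    proj-fixes x Xx with S x in Sx
    ... | true  = ₁.proj-fixes x (cong₂ _∧_ Xx Sx)
    ... | false = ₂.proj-fixes x (cong₂ _∧_ Xx (cong not Sx))

    1≤weight-αβ : 1 ≤ weight α β
    1≤weight-αβ rewrite ==-refl α | ==-refl β =
      ≤-trans (m≤m+n 1 _) (m≤n+m _ (₁.weight α β + ₂.weight α β))

    1≤weight-βα : 1 ≤ weight β α
    1≤weight-βα rewrite ==-refl α | ==-refl β =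
      ≤-trans (m≤n+m 1 _) (m≤n+m _ (₁.weight β α + ₂.weight β α))

    weight₁≤weight : ∀ x y → ₁.weight x y ≤ weight x y
    weight₁≤weight x y = ≤-trans (m≤m+n _ (₂.weight x y)) (m≤m+n _ (edge x y))

    weight₂≤weight : ∀ x y → ₂.weight x y ≤ weight x y
    weight₂≤weight x y = ≤-trans (m≤n+m _ (₁.weight x y)) (m≤m+n _ (edge x y))

    d₁ d₂ : Fin N → Fin N → ℕ
    d₁ u v = dist ₁.weight (₁.proj u) (₁.proj v)
    d₂ u v = dist ₂.weight (₂.proj u) (₂.proj v)

    dist-split : ∀ u v → dist weight (proj u) (proj v) ≤ d₁ u v + d₂ u v + ⟦ S u xor S v ⟧
    dist-split u v with S u in Su | S v in Sv
    ... | true  | true  =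
      ≤-trans (dist-antitone ₁.weight {weight} (₁.proj u) (₁.proj v) (weight₁≤weight _ _))
              (≤-trans (m≤m+n _ (d₂ u v)) (m≤m+n _ 0))
    ... | false | false =
      ≤-trans (dist-antitone ₂.weight {weight} (₂.proj u) (₂.proj v) (weight₂≤weight _ _))
              (≤-trans (m≤n+m _ (d₁ u v)) (m≤m+n _ 0))
    ... | true  | false rewrite proj₁-outside Sv | proj₂-inside Su =
      dist-via-edge weight ₁.weight ₂.weight 1≤weight-αβ _ _
    ... | false | true  rewrite proj₁-outside Su | proj₂-inside Sv =
      subst (λ d → dist weight (₂.proj u) (₁.proj v) ≤ d + 1)
            (+-comm (dist ₂.weight (₂.proj u) β) (dist ₁.weight α (₁.proj v)))
            (dist-via-edge weight ₂.weight ₁.weight 1≤weight-βα (₂.proj u) (₁.proj v))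

    cost-split : cost weight proj ≤ cost ₁.weight ₁.proj + cost ₂.weight ₂.proj + cut G S
    cost-split = begin
      cost weight proj
        ≤⟨ ∑²-mono-≤ (λ u v → *-monoʳ-≤ (e u v) (dist-split u v)) ⟩
      ∑² (λ u v → e u v * (d₁ u v + d₂ u v + ⟦ S u xor S v ⟧))
        ≡⟨ ∑²-cong (λ u v → *-distribˡ-+₃ (e u v) (d₁ u v) (d₂ u v) _) ⟩
      ∑² (λ u v → e u v * d₁ u v + e u v * d₂ u v + e u v * ⟦ S u xor S v ⟧)
        ≡⟨ ∑²-distrib-+ {N} {N} _ _ ⟩
      ∑² (λ u v → e u v * d₁ u v + e u v * d₂ u v) + cut G S
        ≡⟨ cong (_+ cut G S) (∑²-distrib-+ {N} {N} _ _) ⟩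
      cost ₁.weight ₁.proj + cost ₂.weight ₂.proj + cut G S ∎
      where
      open ≤-Reasoning
      e : Fin N → Fin N → ℕ
      e u v = ⟦ adj G u v ⟧
      *-distribˡ-+₃ : ∀ e x y z → e * (x + y + z) ≡ e * x + e * y + e * z
      *-distribˡ-+₃ = solve-∀

    ∑²edge≤2 : ∑² edge ≤ 2
    ∑²edge≤2 = ≤-trans (≤-reflexive (∑²-distrib-+ {N} {N} _ _))
                 (+-mono-≤ (∑²⟦⟧≤1 (λ x y → x == α ∧ y == β) (unique α β))
                           (∑²⟦⟧≤1 (λ x y → x == β ∧ y == α) (unique β α)))
      where
      unique : ∀ γ δ {x y x′ y′} → (x == γ ∧ y == δ) ≡ true → (x′ == γ ∧ y′ == δ) ≡ true →
               x ≡ x′ × y ≡ y′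
      unique γ δ {x} {y} {x′} {y′} p p′ with ∧-true (x == γ) p | ∧-true (x′ == γ) p′
      ... | xγ , yδ | x′γ , y′δ =
        trans (==⇒≡ xγ) (sym (==⇒≡ x′γ)) , trans (==⇒≡ yδ) (sym (==⇒≡ y′δ))

    weight-split : ∑² weight ≤ ∑² ₁.weight + ∑² ₂.weight + 2
    weight-split = begin
      ∑² weight
        ≡⟨ ∑²-distrib-+ {N} {N} _ edge ⟩
      ∑² (λ x y → ₁.weight x y + ₂.weight x y) + ∑² edge
        ≡⟨ cong (_+ ∑² edge) (∑²-distrib-+ {N} {N} ₁.weight ₂.weight) ⟩
      ∑² ₁.weight + ∑² ₂.weight + ∑² edge
        ≤⟨ +-monoʳ-≤ (∑² ₁.weight + ∑² ₂.weight) ∑²edge≤2 ⟩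
      ∑² ₁.weight + ∑² ₂.weight + 2 ∎
      where open ≤-Reasoning

    bound : cost weight proj + ∑² weight + 2 * suc k ≤ 2 * suc k * size X
    bound = begin
      cost weight proj + ∑² weight + 2 * suc k
        ≤⟨ +-monoˡ-≤ (2 * suc k) (+-mono-≤ (≤-trans cost-split (+-monoʳ-≤ (c₁ + c₂) cutS≤2k))
                                           weight-split) ⟩
      (c₁ + c₂ + 2 * k) + (s₁ + s₂ + 2) + 2 * suc k
        ≡⟨ regroup c₁ c₂ s₁ s₂ k ⟩
      (c₁ + s₁ + 2 * suc k) + (c₂ + s₂ + 2 * suc k)
        ≤⟨ +-mono-≤ ₁.bound ₂.bound ⟩
      2 * suc k * size (X ∩ S) + 2 * suc k * size (X ∩ ∁ S)
        ≡⟨ *-distribˡ-+ (2 * suc k) (size (X ∩ S)) (size (X ∩ ∁ S)) ⟨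
      2 * suc k * (size (X ∩ S) + size (X ∩ ∁ S))
        ≡⟨ cong (2 * suc k *_) (size-split X S) ⟨
      2 * suc k * size X ∎
      where
      open ≤-Reasoning
      c₁ = cost ₁.weight ₁.proj
      c₂ = cost ₂.weight ₂.proj
      s₁ = ∑² ₁.weight
      s₂ = ∑² ₂.weight
      regroup : ∀ c₁ c₂ s₁ s₂ k →
        (c₁ + c₂ + 2 * k) + (s₁ + s₂ + 2) + 2 * suc k ≡ (c₁ + s₁ + 2 * suc k) + (c₂ + s₂ + 2 * suc k)
      regroup = solve-∀

  glue : ∀ {X same a b S} → MinCut G same a b S → cut G S ≤ 2 * k →
         Skeleton (X ∩ S) (collapse S same) → Skeleton (X ∩ ∁ S) (collapse (∁ S) same) →
         Skeleton X same
  glue minS cutS≤2k sk₁ sk₂ = record { Glue minS cutS≤2k sk₁ sk₂ }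

  skeleton : ∀ m {X same x₀} → size X ≤ m → X x₀ ≡ true → Separable G k X same → Skeleton X same
  skeleton zero {X} |X|≤0 Xx₀ _ with () ← ≤-trans (size-≥1 {S = X} Xx₀) |X|≤0
  skeleton (suc m) {X} {same} {x₀} |X|≤1+m Xx₀ separable
    with any? (λ a → any? (λ b → (X a ≟ᵇ true) ×-dec (X b ≟ᵇ true) ×-dec ¬? (a ≟ b)))
  ... | no ¬pair = singleton-skeleton Xx₀ only-x₀
    where
    only-x₀ : ∀ x → X x ≡ true → x₀ ≡ x
    only-x₀ x Xx with x₀ ≟ x
    ... | yes x₀≡x = x₀≡x
    ... | no x₀≢x  = ⊥-elim (¬pair (x₀ , x , Xx₀ , Xx , x₀≢x))
  ... | yes (a , b , Xa , Xb , a≢b) with separable Xa Xb a≢b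
  ...   | S₀ , sepS₀ , cutS₀≤2k with min-cut G same a b sepS₀
  ...     | S , minS@((_ , Sa , Sb) , minimal) =
    glue minS (≤-trans (minimal S₀ sepS₀) cutS₀≤2k)
      (skeleton m (part≤m parts≤1+m (size-≥1 {S = X ∩ ∁ S} XSb)) XSa (uncross G {k} minS separable))
      (skeleton m (part≤m (subst (_≤ suc m) (+-comm (size (X ∩ S)) _) parts≤1+m)
                          (size-≥1 {S = X ∩ S} XSa))
                  XSb (uncross G {k} (min-cut-∁ G minS) separable))
    where
    XSa : (X ∩ S) a ≡ true
    XSa = cong₂ _∧_ Xa Sa
    XSb : (X ∩ ∁ S) b ≡ true
    XSb = cong₂ _∧_ Xb (cong not Sb)
    parts≤1+m : size (X ∩ S) + size (X ∩ ∁ S) ≤ suc m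
    parts≤1+m = subst (_≤ suc m) (size-split X S) |X|≤1+m
    part≤m : ∀ {s t} → s + t ≤ suc m → 1 ≤ t → s ≤ m
    part≤m {s} {t} s+t≤1+m 1≤t =
      ≤-pred (≤-trans (subst (_≤ s + t) (+-comm s 1) (+-monoʳ-≤ s 1≤t)) s+t≤1+m)

-- Mader's bound

degree-sum-bound : ∀ {n} (G : Graph (suc n)) k → Separable G k (λ _ → true) _==_ →
                   ∑² (λ u v → ⟦ adj G u v ⟧) + suc k ≤ suc k * suc n
degree-sum-bound {n} G k separable = *-cancelˡ-≤ 2 (begin
  2 * (A + suc k)                                 ≡⟨ *-distribˡ-+ 2 A (suc k) ⟩
  2 * A + 2 * suc k                               ≡⟨ cong (_+ 2 * suc k) (∑²-*ˡ 2 (λ u v → ⟦ adj G u v ⟧)) ⟩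
  ∑² (λ u v → 2 * ⟦ adj G u v ⟧) + 2 * suc k      ≤⟨ +-monoˡ-≤ (2 * suc k) (∑²-mono-≤ edge-cost) ⟩
  ∑² (λ u v → c u v + weight u v) + 2 * suc k     ≡⟨ cong (_+ 2 * suc k) (∑²-distrib-+ c weight) ⟩
  cost G k weight proj + ∑² weight + 2 * suc k    ≤⟨ bound ⟩
  2 * suc k * size {suc n} (λ _ → true)           ≤⟨ *-monoʳ-≤ (2 * suc k) (∑⟦⟧≤n (λ _ → true)) ⟩
  2 * suc k * suc n                               ≡⟨ *-assoc 2 (suc k) (suc n) ⟩
  2 * (suc k * suc n)                             ∎)
  where
  open ≤-Reasoning
  open Skeleton (skeleton G k (suc n) {x₀ = zero} (∑⟦⟧≤n (λ _ → true)) refl separable)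
  A = ∑² (λ u v → ⟦ adj G u v ⟧)

  c : Fin (suc n) → Fin (suc n) → ℕ
  c u v = ⟦ adj G u v ⟧ * dist weight (proj u) (proj v)

  edge-cost : ∀ u v → 2 * ⟦ adj G u v ⟧ ≤ c u v + weight u v
  edge-cost u v rewrite proj-fixes u refl | proj-fixes v refl with adj G u v in uv
  ... | false = z≤n
  ... | true  = subst (λ d → 2 ≤ d + weight u v) (sym (*-identityˡ _)) (2≤dist+weight weight u≢v)
    where
    u≢v : ¬ u ≡ v
    u≢v refl with () ← trans (sym uv) (adj-irr G u)

rainbow-disconnected⇒separable : ∀ {N k} {G : Graph N} (c : EdgeColoring G k) →
                                 RainbowDisconnected c → Separable G k (λ _ → true) _==_
rainbow-disconnected⇒separable {G = G} c disconnected {a} {b} _ _ a≢b with disconnected a b a≢b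
... | R , rainbow , ¬reach with closed-reachable-set G R a
...   | S , (Sa , S⊆reach) , closed =
  S , ((λ u v u==v → cong S (==⇒≡ u==v)) , Sa , Sb) , closed-cut≤ G R c rainbow closed
  where
  Sb : S b ≡ false
  Sb with S b in Sb
  ... | false = refl
  ... | true  = ⊥-elim (¬reach (S⊆reach b Sb))

lemma8 : (n : ℕ) → (G : Graph (suc (suc n))) → Connected G →
    (k : ℕ) → (c : EdgeColoring G k) → RainbowDisconnected c →
    floorAvgDeg G ≤ k
lemma8 n G _ k c disconnected = ≤-pred (m<n*o⇒m/o<n (begin-strict
  degSum G                             ≡⟨ degSum≡∑²adj ⟩
  ∑² (λ u v → ⟦ adj G u v ⟧)           <⟨ m<m+n _ (s≤s z≤n) ⟩
  ∑² (λ u v → ⟦ adj G u v ⟧) + suc k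
    ≤⟨ degree-sum-bound G k (rainbow-disconnected⇒separable c disconnected) ⟩
  suc k * suc (suc n) ∎))
  where
  open ≤-Reasoning
  degSum≡∑²adj : degSum G ≡ ∑² (λ u v → ⟦ adj G u v ⟧)
  degSum≡∑²adj =
    trans (list-sum-allFin (deg G)) (sum-cong-≗ (λ u → list-sum-allFin (λ v → ⟦ adj G u v ⟧)))
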